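{- Let $\mathcal{B}_1$ be the class of linear $\lambda$-terms with exactly one free variable and no closed subterm. Let $\mathcal{B}_1^{\bullet}$ be the class of pairs $(t,s)$ with $t\in\mathcal{B}_1$ and $s$ a distinguished subterm occurrence of $t$, with size $|t|$. Then there is a combinatorial isomorphism $$\mathcal{B}_1 \cong \mathcal{Z} + \mathbf{2}\times\mathcal{Z}^2\times\mathcal{B}_1\times\mathcal{B}_1^{\bullet}.$$ That is, there is a bijection between $\mathcal{B}_1$ and the disjoint union of $\{x\}$ (size $1$) with triples $(\epsilon,t_1,(t_2,s))$, where $\epsilon\in\{\epsilon_1,\epsilon_2\}$, $t_1\in\mathcal{B}_1$ and $(t_2,s)\in\mathcal{B}_1^\bullet$. The triple has size $2+|t_1|+|t_2|$, and the bijection preserves size.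
   Context: $\lambda$-terms are built from variables, applications $(t~u)$ and abstractions $\lambda x.t$, up to $\alpha$-equivalence. A term is linear if each free or bound variable is used exactly once, and closed if it has no free variables. Size is defined by $|x|=1$, $|(t~u)|=1+|t|+|u|$, $|\lambda x.t|=1+|t|$. Subterm occurrences are counted with multiplicity. $\mathcal{Z}$ is the class with one object of size $1$, and $\mathbf{2}$ the class with two objects $\epsilon_1,\epsilon_2$ of size $0$. -}

module Defs where

open import Data.Nat using (ℕ; zero; suc; _+_; _≡ᵇ_)
open import Data.Fin using (Fin; zero; suc; _≟_)
open import Relation.Nullary.Decidable using (⌊_⌋)
open import Data.Bool using (Bool; true; false; _∧_; not; T; if_then_else_)
open import Data.Product using (Σ; _×_; _,_; proj₁)
open import Data.Sum using (_⊎_; inj₁; inj₂)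
open import Data.Unit using (⊤)

-- Well-scoped λ-terms (de Bruijn indices): Tm n = terms with free variables
-- among n scope variables. De Bruijn representation = terms up to α-equivalence.
data Tm (n : ℕ) : Set where
  var : Fin n → Tm n
  app : Tm n → Tm n → Tm n
  lam : Tm (suc n) → Tm n

size : ∀ {n} → Tm n → ℕ
size (var _)   = 1
size (app t u) = suc (size t + size u)
size (lam t)   = suc (size t)

occ : ∀ {n} → Fin n → Tm n → ℕ
occ i (var j)   = if ⌊ i ≟ j ⌋ then 1 else 0
occ i (app t u) = occ i t + occ i u
occ i (lam t)   = occ (suc i) t

linBound : ∀ {n} → Tm n → Bool
linBound (var _)   = true
linBound (app t u) = linBound t ∧ linBound u
linBound (lam t)   = (occ zero t ≡ᵇ 1) ∧ linBound t

closed : ∀ {n} → Tm n → Bool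
closed {n} t = allF (λ i → occ i t ≡ᵇ 0)
  where
  allF : ∀ {m} → (Fin m → Bool) → Bool
  allF {zero}  p = true
  allF {suc m} p = p zero ∧ allF (λ i → p (suc i))

noClosedSub : ∀ {n} → Tm n → Bool
noClosedSub t@(var _)   = not (closed t)
noClosedSub t@(app u v) = not (closed t) ∧ noClosedSub u ∧ noClosedSub v
noClosedSub t@(lam u)   = not (closed t) ∧ noClosedSub u

isB1 : Tm 1 → Bool
isB1 t = (occ zero t ≡ᵇ 1) ∧ linBound t ∧ noClosedSub t

B1 : Set
B1 = Σ (Tm 1) (λ t → T (isB1 t))

sizeB1 : B1 → ℕ
sizeB1 (t , _) = size t

data Pos {n : ℕ} : Tm n → Set where
  here : ∀ {t} → Pos t
  appL : ∀ {t u} → Pos t → Pos (app t u)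
  appR : ∀ {t u} → Pos u → Pos (app t u)
  under : ∀ {t} → Pos t → Pos (lam t)

B1• : Set
B1• = Σ B1 (λ b → Pos (proj₁ b))

sizeB1• : B1• → ℕ
sizeB1• (b , _) = sizeB1 b

-- Z + 2 × Z² × B₁ × B₁•  (Bool plays the role of 2 = {ε₁, ε₂})
RHS : Set
RHS = ⊤ ⊎ (Bool × B1 × B1•)

sizeRHS : RHS → ℕ
sizeRHS (inj₁ _)              = 1
sizeRHS (inj₂ (_ , t₁ , t₂s)) = 2 + sizeB1 t₁ + sizeB1• t₂s

{-# OPTIONS --safe #-}
-- A term of B₁ is either x or λy.u with x and y each occurring once in u (an application
-- cannot be in B₁: its side without x would be closed).  Walk from the root of u towards x
-- and stop at the first application whose side containing x mentions no other variable.
-- That side is a term t₁ ∈ B₁; contracting the application to its other side s leaves a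
-- term t₂ ∈ B₁ in the variable y with s marked, and the side on which t₁ sat is the choice
-- in 2.  Conversely, grafting t₁ next to the marked subterm of t₂ and abstracting y is
-- undone by the walk: it cannot stop earlier, because t₂ has no closed subterm, so every
-- node of t₂ above the mark mentions a variable other than x.  The graft adds one λ and
-- one application, whence the size 2 + |t₁| + |t₂|.
module Submission where

open import Defs
open import Algebra.Bundles using (CommutativeMonoid)
open import Data.Bool using (Bool; true; false; _∧_; not; T; if_then_else_)
open import Data.Bool.Properties
  using (∧-conicalˡ; ∧-conicalʳ; ∧-assoc; ∧-comm; ∧-commutativeMonoid; not-injective; ⇔→≡; T-irrelevant; T-≡)
open import Data.Fin using (Fin; zero; suc; fromℕ; inject₁; _≟_)
open import Data.Fin.Properties using (fromℕ≢inject₁)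
open import Data.Maybe as Maybe using (Maybe; just; nothing; maybe′; zipWith)
open import Data.Maybe.Properties using (just-injective)
open import Data.Nat using (ℕ; zero; suc; _+_; _≡ᵇ_)
open import Data.Nat.Properties
  using (+-comm; +-identityʳ; +-assoc; +-suc; +-commutativeSemigroup; m+n≡0⇒m≡0; m+n≡0⇒n≡0; ≡ᵇ⇒≡)
open import Data.Product using (Σ; ∃; _×_; _,_; proj₁; proj₂)
open import Data.Sum using (inj₁; inj₂)
open import Data.Unit using (⊤; tt)
open import Function.Bundles using (_↔_; Inverse; Equivalence; mk↔ₛ′; mk⇔)
open import Relation.Nullary using (yes; no; ¬_; contradiction)
open import Relation.Binary.PropositionalEquality using (_≡_; _≢_; refl; sym; trans; cong; cong₂; subst)
open import Algebra.Properties.CommutativeSemigroup +-commutativeSemigroup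
  using () renaming (xy∙z≈xz∙y to +-rightComm)
open import Algebra.Properties.CommutativeSemigroup (CommutativeMonoid.commutativeSemigroup ∧-commutativeMonoid)
  using () renaming (xy∙z≈xz∙y to ∧-rightComm)

variable
  m n : ℕ

m+n≡1⇒m≡1×n≡0 : ∀ m n → m + n ≡ 1 → not (m ≡ᵇ 0) ≡ true → m ≡ 1 × n ≡ 0
m+n≡1⇒m≡1×n≡0 1 0 _ _ = refl , refl

m+n≡1⇒m≡0×n≡1 : ∀ m n → m + n ≡ 1 → not (m ≡ᵇ 0) ≡ false → m ≡ 0 × n ≡ 1
m+n≡1⇒m≡0×n≡1 0 n n≡1 _ = refl , n≡1

occ-var-self : (i : Fin n) → occ i (var i) ≡ 1
occ-var-self i with i ≟ i
... | yes _  = refl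
... | no i≢i = contradiction refl i≢i

occ-var-≢ : {i j : Fin n} → i ≢ j → occ i (var j) ≡ 0
occ-var-≢ {i = i} {j} i≢j with i ≟ j
... | yes i≡j = contradiction i≡j i≢j
... | no _    = refl

-- closed t unfolds to the test of variable zero followed by closed (lam t).
closed⇒occ≡0 : (t : Tm n) → closed t ≡ true → ∀ i → occ i t ≡ 0
closed⇒occ≡0 {suc n} t h zero with occ zero t | h
... | zero | _ = refl
closed⇒occ≡0 {suc n} t h (suc i) with occ zero t | h
... | zero | h′ = closed⇒occ≡0 (lam t) h′ i

occ≡0⇒closed : (t : Tm n) → (∀ i → occ i t ≡ 0) → closed t ≡ true
occ≡0⇒closed {zero}  t h = refl
occ≡0⇒closed {suc n} t h with occ zero t | h zero
... | zero | _ = occ≡0⇒closed (lam t) (λ i → h (suc i))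

occ≡suc⇒¬closed : (t : Tm n) (i : Fin n) {k : ℕ} → occ i t ≡ suc k → closed t ≡ false
occ≡suc⇒¬closed t i i∈t with closed t in c
... | false = refl
... | true with trans (sym i∈t) (closed⇒occ≡0 t c i)
... | ()

noClosedSub⇒¬closed : (t : Tm n) → noClosedSub t ≡ true → closed t ≡ false
noClosedSub⇒¬closed (var i)   h = not-injective h
noClosedSub⇒¬closed (app t u) h = not-injective (∧-conicalˡ _ _ h)
noClosedSub⇒¬closed (lam t)   h = not-injective (∧-conicalˡ _ _ h)

noClosedSub-app : (t u : Tm n) → closed (app t u) ≡ false →
                  noClosedSub t ≡ true → noClosedSub u ≡ true → noClosedSub (app t u) ≡ true
noClosedSub-app t u c p q rewrite c | p | q = refl

noClosedSub-lam : (t : Tm (suc n)) → closed (lam t) ≡ false →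
                  noClosedSub t ≡ true → noClosedSub (lam t) ≡ true
noClosedSub-lam t c p rewrite c | p = refl

noClosedSub-app⁻ : (t u : Tm n) → noClosedSub (app t u) ≡ true →
                   noClosedSub t ≡ true × noClosedSub u ≡ true
noClosedSub-app⁻ t u h = ∧-conicalˡ _ _ both , ∧-conicalʳ _ _ both
  where both = ∧-conicalʳ (not (closed (app t u))) _ h

noClosedSub-lam⁻ : (t : Tm (suc n)) → noClosedSub (lam t) ≡ true → noClosedSub t ≡ true
noClosedSub-lam⁻ t h = ∧-conicalʳ (not (closed (lam t))) _ h

linBound-lam⁻ : (t : Tm (suc n)) → linBound (lam t) ≡ true → occ zero t ≡ 1 × linBound t ≡ true
linBound-lam⁻ t h =
  ≡ᵇ⇒≡ (occ zero t) 1 (Equivalence.from T-≡ (∧-conicalˡ _ _ h)) , ∧-conicalʳ (occ zero t ≡ᵇ 1) _ h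

-- Renaming along a partial inverse

Ren : ℕ → ℕ → Set
Ren m n = Fin m → Fin n

PartialRen : ℕ → ℕ → Set
PartialRen m n = Fin m → Maybe (Fin n)

ext : Ren m n → Ren (suc m) (suc n)
ext ρ zero    = zero
ext ρ (suc i) = suc (ρ i)

pext : PartialRen m n → PartialRen (suc m) (suc n)
pext σ zero    = just zero
pext σ (suc i) = Maybe.map suc (σ i)

rename : Ren m n → Tm m → Tm n
rename ρ (var i)   = var (ρ i)
rename ρ (app t u) = app (rename ρ t) (rename ρ u)
rename ρ (lam t)   = lam (rename (ext ρ) t)

prename : PartialRen m n → Tm m → Maybe (Tm n)
prename σ (var i)   = Maybe.map var (σ i)
prename σ (app t u) = zipWith app (prename σ t) (prename σ u)
prename σ (lam t)   = Maybe.map lam (prename (pext σ) t)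

record PartialInverse (ρ : Ren m n) (σ : PartialRen n m) : Set where
  field
    inverseˡ : ∀ i → σ (ρ i) ≡ just i
    inverseʳ : ∀ {j i} → σ j ≡ just i → ρ i ≡ j
open PartialInverse

ext-partialInverse : {ρ : Ren m n} {σ : PartialRen n m} →
                     PartialInverse ρ σ → PartialInverse (ext ρ) (pext σ)
inverseˡ (ext-partialInverse inv) zero = refl
inverseˡ (ext-partialInverse inv) (suc i) rewrite inverseˡ inv i = refl
inverseʳ (ext-partialInverse inv) {zero} refl = refl
inverseʳ (ext-partialInverse {σ = σ} inv) {suc j} eq with σ j in σj
inverseʳ (ext-partialInverse {σ = σ} inv) {suc j} refl | just i = cong suc (inverseʳ inv σj)

occ-rename : {ρ : Ren m n} {σ : PartialRen n m} → PartialInverse ρ σ →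
             ∀ j t → occ j (rename ρ t) ≡ maybe′ (λ i → occ i t) 0 (σ j)
occ-rename {ρ = ρ} {σ} inv j (var k) with j ≟ ρ k
... | yes refl rewrite inverseˡ inv k = sym (occ-var-self k)
... | no j≢ρk with σ j in σj
...   | nothing = refl
...   | just i  = sym (occ-var-≢ λ { refl → j≢ρk (sym (inverseʳ inv σj)) })
occ-rename {σ = σ} inv j (app t u) rewrite occ-rename inv j t | occ-rename inv j u with σ j
... | just i  = refl
... | nothing = refl
occ-rename {σ = σ} inv j (lam t) rewrite occ-rename (ext-partialInverse inv) (suc j) t with σ j
... | just i  = refl
... | nothing = refl

prename-rename : {ρ : Ren m n} {σ : PartialRen n m} → PartialInverse ρ σ →
                 ∀ t → prename σ (rename ρ t) ≡ just t
prename-rename inv (var i)   rewrite inverseˡ inv i = refl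
prename-rename inv (app t u) rewrite prename-rename inv t | prename-rename inv u = refl
prename-rename inv (lam t)   rewrite prename-rename (ext-partialInverse inv) t = refl

rename-prename : {ρ : Ren m n} {σ : PartialRen n m} → PartialInverse ρ σ →
                 ∀ u {t} → prename σ u ≡ just t → rename ρ t ≡ u
rename-prename {σ = σ} inv (var j) eq with σ j in σj
rename-prename inv (var j) refl | just i = cong var (inverseʳ inv σj)
rename-prename {σ = σ} inv (app u v) eq with prename σ u in σu | prename σ v in σv
rename-prename inv (app u v) refl | just _ | just _ =
  cong₂ app (rename-prename inv u σu) (rename-prename inv v σv)
rename-prename {σ = σ} inv (lam u) eq with prename (pext σ) u in σu
rename-prename inv (lam u) refl | just _ = cong lam (rename-prename (ext-partialInverse inv) u σu)

prename-defined : (σ : PartialRen m n) (u : Tm m) →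
                  (∀ j → σ j ≡ nothing → occ j u ≡ 0) → ∃ λ t → prename σ u ≡ just t
prename-defined σ (var j) unused with σ j in σj
... | just i  = var i , refl
... | nothing with trans (sym (occ-var-self j)) (unused j σj)
... | ()
prename-defined σ (app u v) unused
  with prename-defined σ u (λ j e → m+n≡0⇒m≡0 _ (unused j e))
     | prename-defined σ v (λ j e → m+n≡0⇒n≡0 (occ j u) (unused j e))
... | t , σu | t′ , σv rewrite σu | σv = app t t′ , refl
prename-defined σ (lam u) unused with prename-defined (pext σ) u unused′
  where
  unused′ : ∀ j → pext σ j ≡ nothing → occ j u ≡ 0
  unused′ (suc j) e with σ j in σj
  unused′ (suc j) () | just _
  ... | nothing = unused j σj
... | t , σu rewrite σu = lam t , refl

prename-appˡ : (σ : PartialRen m n) (t u : Tm m) →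
               prename σ t ≡ nothing → prename σ (app t u) ≡ nothing
prename-appˡ σ t u eq rewrite eq = refl

prename-appʳ : (σ : PartialRen m n) (t u : Tm m) →
               prename σ u ≡ nothing → prename σ (app t u) ≡ nothing
prename-appʳ σ t u eq with prename σ t
... | just _  rewrite eq = refl
... | nothing = refl

size-rename : (ρ : Ren m n) (t : Tm m) → size (rename ρ t) ≡ size t
size-rename ρ (var i)   = refl
size-rename ρ (app t u) = cong₂ (λ a b → suc (a + b)) (size-rename ρ t) (size-rename ρ u)
size-rename ρ (lam t)   = cong suc (size-rename (ext ρ) t)

linBound-rename : {ρ : Ren m n} {σ : PartialRen n m} → PartialInverse ρ σ →
                  ∀ t → linBound (rename ρ t) ≡ linBound t
linBound-rename inv (var i) = refl
linBound-rename inv (app t u) rewrite linBound-rename inv t | linBound-rename inv u = refl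
linBound-rename inv (lam t)
  rewrite occ-rename (ext-partialInverse inv) zero t | linBound-rename (ext-partialInverse inv) t = refl

closed-rename : {ρ : Ren m n} {σ : PartialRen n m} → PartialInverse ρ σ →
                ∀ t → closed (rename ρ t) ≡ closed t
closed-rename {ρ = ρ} {σ} inv t = ⇔→≡ (mk⇔ reflect preserve)
  where
  reflect : closed (rename ρ t) ≡ true → closed t ≡ true
  reflect h = occ≡0⇒closed t λ i →
    trans (cong (maybe′ (λ k → occ k t) 0) (sym (inverseˡ inv i)))
          (trans (sym (occ-rename inv (ρ i) t)) (closed⇒occ≡0 (rename ρ t) h (ρ i)))
  preserve : closed t ≡ true → closed (rename ρ t) ≡ true
  preserve h = occ≡0⇒closed (rename ρ t) λ j → trans (occ-rename inv j t) (absent (σ j))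
    where
    absent : ∀ k → maybe′ (λ i → occ i t) 0 k ≡ 0
    absent (just i) = closed⇒occ≡0 t h i
    absent nothing  = refl

noClosedSub-rename : {ρ : Ren m n} {σ : PartialRen n m} → PartialInverse ρ σ →
                     ∀ t → noClosedSub (rename ρ t) ≡ noClosedSub t
noClosedSub-rename inv (var i) rewrite closed-rename inv (var i) = refl
noClosedSub-rename inv (app t u)
  rewrite closed-rename inv (app t u) | noClosedSub-rename inv t | noClosedSub-rename inv u = refl
noClosedSub-rename inv (lam t)
  rewrite closed-rename inv (lam t) | noClosedSub-rename (ext-partialInverse inv) t = refl

dropLast : PartialRen (suc n) n
dropLast {zero}  zero    = nothing
dropLast {suc n} zero    = just zero
dropLast {suc n} (suc i) = Maybe.map suc (dropLast i)

dropLast-inject₁ : (i : Fin n) → dropLast (inject₁ i) ≡ just i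
dropLast-inject₁ zero    = refl
dropLast-inject₁ (suc i) rewrite dropLast-inject₁ i = refl

dropLast-fromℕ : ∀ n → dropLast (fromℕ n) ≡ nothing
dropLast-fromℕ zero    = refl
dropLast-fromℕ (suc n) rewrite dropLast-fromℕ n = refl

dropLast≡just : {j : Fin (suc n)} {i : Fin n} → dropLast j ≡ just i → inject₁ i ≡ j
dropLast≡just {suc n} {zero} refl = refl
dropLast≡just {suc n} {suc j} eq with dropLast j in e
dropLast≡just {suc n} {suc j} refl | just k = cong suc (dropLast≡just e)

dropLast≡nothing : (j : Fin (suc n)) → dropLast j ≡ nothing → j ≡ fromℕ n
dropLast≡nothing {zero}  zero    _ = refl
dropLast≡nothing {suc n} (suc j) eq with dropLast j in e
dropLast≡nothing {suc n} (suc j) refl | nothing = cong suc (dropLast≡nothing j e)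

onlyLast : PartialRen (suc n) 1
onlyLast {zero}  zero    = just zero
onlyLast {suc n} zero    = nothing
onlyLast {suc n} (suc i) = onlyLast i

onlyLast-fromℕ : ∀ n → onlyLast (fromℕ n) ≡ just zero
onlyLast-fromℕ zero    = refl
onlyLast-fromℕ (suc n) = onlyLast-fromℕ n

onlyLast-inject₁ : (i : Fin n) → onlyLast (inject₁ i) ≡ nothing
onlyLast-inject₁ zero    = refl
onlyLast-inject₁ (suc i) = onlyLast-inject₁ i

onlyLast≡just : {j : Fin (suc n)} {i : Fin 1} → onlyLast j ≡ just i → fromℕ n ≡ j
onlyLast≡just {zero}  {zero}  _  = refl
onlyLast≡just {suc n} {suc j} eq = cong suc (onlyLast≡just eq)

onlyLast≡nothing : (j : Fin (suc n)) → onlyLast j ≡ nothing → ∃ λ i → j ≡ inject₁ i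
onlyLast≡nothing {suc n} zero    _ = zero , refl
onlyLast≡nothing {suc n} (suc j) eq with onlyLast≡nothing j eq
... | i , refl = suc i , refl

-- In de Bruijn notation the last variable of a scope is the outermost one: it plays the role of x.
lastVar : Ren 1 (suc n)
lastVar {n} _ = fromℕ n

inject₁-partialInverse : PartialInverse (inject₁ {n}) dropLast
inverseˡ inject₁-partialInverse = dropLast-inject₁
inverseʳ inject₁-partialInverse = dropLast≡just

lastVar-partialInverse : PartialInverse (lastVar {n}) onlyLast
inverseˡ (lastVar-partialInverse {n}) zero = onlyLast-fromℕ n
inverseʳ lastVar-partialInverse {i = zero} = onlyLast≡just

weaken : Tm n → Tm (suc n)
weaken = rename inject₁

strengthen : Tm (suc n) → Maybe (Tm n)
strengthen = prename dropLast

toLast : Tm 1 → Tm (suc n)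
toLast = rename lastVar

fromLast : Tm (suc n) → Maybe (Tm 1)
fromLast = prename onlyLast

occ-weaken-inject₁ : (i : Fin n) (t : Tm n) → occ (inject₁ i) (weaken t) ≡ occ i t
occ-weaken-inject₁ i t
  rewrite occ-rename inject₁-partialInverse (inject₁ i) t | dropLast-inject₁ i = refl

occ-weaken-last : (t : Tm n) → occ (fromℕ n) (weaken t) ≡ 0
occ-weaken-last {n} t
  rewrite occ-rename inject₁-partialInverse (fromℕ n) t | dropLast-fromℕ n = refl

occ-toLast-inject₁ : (i : Fin n) (t : Tm 1) → occ (inject₁ i) (toLast {n} t) ≡ 0
occ-toLast-inject₁ i t
  rewrite occ-rename lastVar-partialInverse (inject₁ i) t | onlyLast-inject₁ i = refl

occ-toLast-last : (t : Tm 1) → occ (fromℕ n) (toLast {n} t) ≡ occ zero t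
occ-toLast-last {n} t
  rewrite occ-rename lastVar-partialInverse (fromℕ n) t | onlyLast-fromℕ n = refl

fromLast≡just⇒occ-inject₁ : (u : Tm (suc n)) {t₁ : Tm 1} → fromLast u ≡ just t₁ →
                            ∀ i → occ (inject₁ i) u ≡ 0
fromLast≡just⇒occ-inject₁ u {t₁} eq i =
  trans (cong (occ (inject₁ i)) (sym (rename-prename lastVar-partialInverse u eq)))
        (occ-toLast-inject₁ i t₁)

occ-zero⇒notFromLast : (u : Tm (suc (suc n))) {k : ℕ} → occ zero u ≡ suc k → fromLast u ≡ nothing
occ-zero⇒notFromLast u y∈u with fromLast u in eq
... | nothing = refl
... | just _ with trans (sym y∈u) (fromLast≡just⇒occ-inject₁ u eq zero)
... | ()

linBound-weaken : (t : Tm n) → linBound (weaken t) ≡ linBound t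
linBound-weaken = linBound-rename inject₁-partialInverse

linBound-toLast : (t : Tm 1) → linBound (toLast {n} t) ≡ linBound t
linBound-toLast {n} = linBound-rename (lastVar-partialInverse {n})

noClosedSub-weaken : (t : Tm n) → noClosedSub (weaken t) ≡ noClosedSub t
noClosedSub-weaken = noClosedSub-rename inject₁-partialInverse

noClosedSub-toLast : (t : Tm 1) → noClosedSub (toLast {n} t) ≡ noClosedSub t
noClosedSub-toLast {n} = noClosedSub-rename (lastVar-partialInverse {n})

strengthen-weaken : (t : Tm n) → strengthen (weaken t) ≡ just t
strengthen-weaken = prename-rename inject₁-partialInverse

fromLast-toLast : (t : Tm 1) → fromLast (toLast {n} t) ≡ just t
fromLast-toLast {n} = prename-rename (lastVar-partialInverse {n})

strengthen-defined : (u : Tm (suc n)) → occ (fromℕ n) u ≡ 0 → ∃ λ t → strengthen u ≡ just t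
strengthen-defined {n} u x∉u =
  prename-defined dropLast u (λ j e → subst (λ k → occ k u ≡ 0) (sym (dropLast≡nothing j e)) x∉u)


-- Grafting

-- The new last variable of the scope is the free variable of t₁; the Bool says
-- whether t₁ goes to the left of the marked subterm.
graft : (t : Tm n) → Pos t → Bool → Tm 1 → Tm (suc n)
graft t         here      true  t₁ = app (toLast t₁) (weaken t)
graft t         here      false t₁ = app (weaken t) (toLast t₁)
graft (app t u) (appL s)  b     t₁ = app (graft t s b t₁) (weaken u)
graft (app t u) (appR s)  b     t₁ = app (weaken t) (graft u s b t₁)
graft (lam t)   (under s) b     t₁ = lam (graft t s b t₁)

occ-graft-inject₁ : (i : Fin n) (t : Tm n) (s : Pos t) (b : Bool) (t₁ : Tm 1) →
                    occ (inject₁ i) (graft t s b t₁) ≡ occ i t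
occ-graft-inject₁ i t here true t₁ rewrite occ-toLast-inject₁ i t₁ = occ-weaken-inject₁ i t
occ-graft-inject₁ i t here false t₁
  rewrite occ-toLast-inject₁ i t₁ | occ-weaken-inject₁ i t = +-identityʳ _
occ-graft-inject₁ i (app t u) (appL s) b t₁
  rewrite occ-graft-inject₁ i t s b t₁ | occ-weaken-inject₁ i u = refl
occ-graft-inject₁ i (app t u) (appR s) b t₁
  rewrite occ-graft-inject₁ i u s b t₁ | occ-weaken-inject₁ i t = refl
occ-graft-inject₁ i (lam t) (under s) b t₁ = occ-graft-inject₁ (suc i) t s b t₁

occ-graft-last : (t : Tm n) (s : Pos t) (b : Bool) (t₁ : Tm 1) →
                 occ (fromℕ n) (graft t s b t₁) ≡ occ zero t₁
occ-graft-last {n} t here true t₁ rewrite occ-toLast-last {n} t₁ | occ-weaken-last t = +-identityʳ _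
occ-graft-last {n} t here false t₁ rewrite occ-toLast-last {n} t₁ | occ-weaken-last t = refl
occ-graft-last (app t u) (appL s) b t₁
  rewrite occ-graft-last t s b t₁ | occ-weaken-last u = +-identityʳ _
occ-graft-last (app t u) (appR s) b t₁
  rewrite occ-graft-last u s b t₁ | occ-weaken-last t = refl
occ-graft-last (lam t) (under s) b t₁ = occ-graft-last t s b t₁

linBound-graft : (t : Tm n) (s : Pos t) (b : Bool) (t₁ : Tm 1) →
                 linBound (graft t s b t₁) ≡ linBound t ∧ linBound t₁
linBound-graft t here true t₁ =
  trans (cong₂ _∧_ (linBound-toLast t₁) (linBound-weaken t)) (∧-comm (linBound t₁) (linBound t))
linBound-graft t here false t₁ = cong₂ _∧_ (linBound-weaken t) (linBound-toLast t₁)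
linBound-graft (app t u) (appL s) b t₁ =
  trans (cong₂ _∧_ (linBound-graft t s b t₁) (linBound-weaken u))
        (∧-rightComm (linBound t) (linBound t₁) (linBound u))
linBound-graft (app t u) (appR s) b t₁ =
  trans (cong₂ _∧_ (linBound-weaken t) (linBound-graft u s b t₁))
        (sym (∧-assoc (linBound t) (linBound u) (linBound t₁)))
linBound-graft (lam t) (under s) b t₁ =
  trans (cong₂ (λ k l → (k ≡ᵇ 1) ∧ l) (occ-graft-inject₁ zero t s b t₁) (linBound-graft t s b t₁))
        (sym (∧-assoc (occ zero t ≡ᵇ 1) (linBound t) (linBound t₁)))

size-graft : (t : Tm n) (s : Pos t) (b : Bool) (t₁ : Tm 1) →
             size (graft t s b t₁) ≡ suc (size t + size t₁)
size-graft t here true t₁ =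
  cong suc (trans (cong₂ _+_ (size-rename lastVar t₁) (size-rename inject₁ t))
                  (+-comm (size t₁) (size t)))
size-graft t here false t₁ = cong suc (cong₂ _+_ (size-rename inject₁ t) (size-rename lastVar t₁))
size-graft (app t u) (appL s) b t₁ =
  cong suc (trans (cong₂ _+_ (size-graft t s b t₁) (size-rename inject₁ u))
                  (cong suc (+-rightComm (size t) (size t₁) (size u))))
size-graft (app t u) (appR s) b t₁ =
  cong suc (trans (cong₂ _+_ (size-rename inject₁ t) (size-graft u s b t₁))
                  (trans (+-suc (size t) _) (cong suc (sym (+-assoc (size t) (size u) (size t₁))))))
size-graft (lam t) (under s) b t₁ = cong suc (size-graft t s b t₁)

graft-¬closed : (t : Tm n) (s : Pos t) (b : Bool) (t₁ : Tm 1) →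
                occ zero t₁ ≡ 1 → closed (graft t s b t₁) ≡ false
graft-¬closed {n} t s b t₁ x∈t₁ =
  occ≡suc⇒¬closed (graft t s b t₁) (fromℕ n) (trans (occ-graft-last t s b t₁) x∈t₁)

graft-notFromLast : (t : Tm n) (s : Pos t) (b : Bool) (t₁ : Tm 1) →
                    closed t ≡ false → fromLast (graft t s b t₁) ≡ nothing
graft-notFromLast t s b t₁ t-open with fromLast (graft t s b t₁) in eq
... | nothing = refl
... | just _ with trans (sym t-open) (occ≡0⇒closed t λ i →
                   trans (sym (occ-graft-inject₁ i t s b t₁))
                         (fromLast≡just⇒occ-inject₁ (graft t s b t₁) eq i))
... | ()

graft-notFromLast⁻ : (t : Tm n) (s : Pos t) (b : Bool) (t₁ : Tm 1) →
                     fromLast (graft t s b t₁) ≡ nothing → closed t ≡ false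
graft-notFromLast⁻ t s b t₁ eq with closed t in c
... | false = refl
... | true with prename-defined onlyLast (graft t s b t₁) onlyMentionsLast
  where
  onlyMentionsLast : ∀ j → onlyLast j ≡ nothing → occ j (graft t s b t₁) ≡ 0
  onlyMentionsLast j e with onlyLast≡nothing j e
  ... | i , refl = trans (occ-graft-inject₁ i t s b t₁) (closed⇒occ≡0 t c i)
... | _ , defined with trans (sym eq) defined
... | ()

-- After grafting, the nodes above the mark contain x, so noClosedSub of the graft says
-- nothing about whether they were closed in t.
OpenAbove : (t : Tm n) → Pos t → Set
OpenAbove t         here      = ⊤
OpenAbove (app t u) (appL s)  = closed (app t u) ≡ false × OpenAbove t s
OpenAbove (app t u) (appR s)  = closed (app t u) ≡ false × OpenAbove u s
OpenAbove (lam t)   (under s) = closed (lam t) ≡ false × OpenAbove t s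

noClosedSub-graft : (t : Tm n) (s : Pos t) (b : Bool) (t₁ : Tm 1) → occ zero t₁ ≡ 1 →
                    noClosedSub t ≡ true → noClosedSub t₁ ≡ true →
                    noClosedSub (graft t s b t₁) ≡ true
noClosedSub-graft t here true t₁ x∈t₁ nt nt₁ =
  noClosedSub-app (toLast t₁) (weaken t) (graft-¬closed t here true t₁ x∈t₁)
    (trans (noClosedSub-toLast t₁) nt₁) (trans (noClosedSub-weaken t) nt)
noClosedSub-graft t here false t₁ x∈t₁ nt nt₁ =
  noClosedSub-app (weaken t) (toLast t₁) (graft-¬closed t here false t₁ x∈t₁)
    (trans (noClosedSub-weaken t) nt) (trans (noClosedSub-toLast t₁) nt₁)
noClosedSub-graft (app t u) (appL s) b t₁ x∈t₁ ntu nt₁ =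
  noClosedSub-app (graft t s b t₁) (weaken u) (graft-¬closed (app t u) (appL s) b t₁ x∈t₁)
    (noClosedSub-graft t s b t₁ x∈t₁ (proj₁ (noClosedSub-app⁻ t u ntu)) nt₁)
    (trans (noClosedSub-weaken u) (proj₂ (noClosedSub-app⁻ t u ntu)))
noClosedSub-graft (app t u) (appR s) b t₁ x∈t₁ ntu nt₁ =
  noClosedSub-app (weaken t) (graft u s b t₁) (graft-¬closed (app t u) (appR s) b t₁ x∈t₁)
    (trans (noClosedSub-weaken t) (proj₁ (noClosedSub-app⁻ t u ntu)))
    (noClosedSub-graft u s b t₁ x∈t₁ (proj₂ (noClosedSub-app⁻ t u ntu)) nt₁)
noClosedSub-graft (lam t) (under s) b t₁ x∈t₁ nt nt₁ =
  noClosedSub-lam (graft t s b t₁) (graft-¬closed (lam t) (under s) b t₁ x∈t₁)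
    (noClosedSub-graft t s b t₁ x∈t₁ (noClosedSub-lam⁻ t nt) nt₁)

noClosedSub-graft⁻ : (t : Tm n) (s : Pos t) (b : Bool) (t₁ : Tm 1) → OpenAbove t s →
                     noClosedSub (graft t s b t₁) ≡ true →
                     noClosedSub t ≡ true × noClosedSub t₁ ≡ true
noClosedSub-graft⁻ t here true t₁ _ ng =
  trans (sym (noClosedSub-weaken t)) (proj₂ sides) , trans (sym (noClosedSub-toLast t₁)) (proj₁ sides)
  where sides = noClosedSub-app⁻ (toLast t₁) (weaken t) ng
noClosedSub-graft⁻ t here false t₁ _ ng =
  trans (sym (noClosedSub-weaken t)) (proj₁ sides) , trans (sym (noClosedSub-toLast t₁)) (proj₂ sides)
  where sides = noClosedSub-app⁻ (weaken t) (toLast t₁) ng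
noClosedSub-graft⁻ (app t u) (appL s) b t₁ (open-tu , above) ng
  with sides ← noClosedSub-app⁻ (graft t s b t₁) (weaken u) ng
  with noClosedSub-graft⁻ t s b t₁ above (proj₁ sides)
... | nt , nt₁ = noClosedSub-app t u open-tu nt (trans (sym (noClosedSub-weaken u)) (proj₂ sides)) , nt₁
noClosedSub-graft⁻ (app t u) (appR s) b t₁ (open-tu , above) ng
  with sides ← noClosedSub-app⁻ (weaken t) (graft u s b t₁) ng
  with noClosedSub-graft⁻ u s b t₁ above (proj₂ sides)
... | nu , nt₁ = noClosedSub-app t u open-tu (trans (sym (noClosedSub-weaken t)) (proj₁ sides)) nu , nt₁
noClosedSub-graft⁻ (lam t) (under s) b t₁ (open-t , above) ng
  with noClosedSub-graft⁻ t s b t₁ above (noClosedSub-lam⁻ (graft t s b t₁) ng)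
... | nt , nt₁ = noClosedSub-lam t open-t nt , nt₁

-- Splitting at the last variable

Splitting : ℕ → Set
Splitting n = Σ (Tm n) (λ t → Pos t × Bool × Tm 1)

plug : Splitting n → Tm (suc n)
plug (t , s , b , t₁) = graft t s b t₁

OpenAboveMark : Splitting n → Set
OpenAboveMark (t , s , _ , _) = OpenAbove t s

mentionsLast : Tm (suc n) → Bool
mentionsLast {n} u = not (occ (fromℕ n) u ≡ᵇ 0)

splitAppˡ : Maybe (Tm 1) → Maybe (Splitting n) → Maybe (Tm n) → Maybe (Splitting n)
splitAppˡ (just t₁) _                       (just q) = just (q , here , true , t₁)
splitAppˡ nothing   (just (t , s , b , t₁)) (just q) = just (app t q , appL s , b , t₁)
splitAppˡ _         _                       _        = nothing

splitAppʳ : Maybe (Tm 1) → Maybe (Splitting n) → Maybe (Tm n) → Maybe (Splitting n)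
splitAppʳ (just t₁) _                       (just p) = just (p , here , false , t₁)
splitAppʳ nothing   (just (t , s , b , t₁)) (just p) = just (app p t , appR s , b , t₁)
splitAppʳ _         _                       _        = nothing

underSplitting : Splitting (suc n) → Splitting n
underSplitting (t , s , b , t₁) = lam t , under s , b , t₁

split : Tm (suc n) → Maybe (Splitting n)
split (var _)   = nothing
split (app p q) = if mentionsLast p
                  then splitAppˡ (fromLast p) (split p) (strengthen q)
                  else splitAppʳ (fromLast q) (split q) (strengthen p)
split (lam p)   = Maybe.map underSplitting (split p)

SplitsOpenly : Tm (suc n) → Set
SplitsOpenly u = ∃ λ r → split u ≡ just r × OpenAboveMark r

plug-split : (u : Tm (suc n)) {r : Splitting n} → split u ≡ just r → plug r ≡ u
plug-split (app p q) eq with mentionsLast p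
... | true with fromLast p in p₁ | split p in sp | strengthen q in q′ | eq
...   | just _  | _      | just _ | refl =
  cong₂ app (rename-prename lastVar-partialInverse p p₁) (rename-prename inject₁-partialInverse q q′)
...   | nothing | just _ | just _ | refl =
  cong₂ app (plug-split p sp) (rename-prename inject₁-partialInverse q q′)
plug-split (app p q) eq | false with fromLast q in q₁ | split q in sq | strengthen p in p′ | eq
...   | just _  | _      | just _ | refl =
  cong₂ app (rename-prename inject₁-partialInverse p p′) (rename-prename lastVar-partialInverse q q₁)
...   | nothing | just _ | just _ | refl =
  cong₂ app (rename-prename inject₁-partialInverse p p′) (plug-split q sq)
plug-split (lam p) eq with split p in sp | eq
... | just _ | refl = cong lam (plug-split p sp)

mentionsLast-toLast : (t₁ : Tm 1) → occ zero t₁ ≡ 1 → mentionsLast (toLast {n} t₁) ≡ true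
mentionsLast-toLast {n} t₁ x∈t₁ rewrite occ-toLast-last {n} t₁ | x∈t₁ = refl

mentionsLast-weaken : (t : Tm n) → mentionsLast (weaken t) ≡ false
mentionsLast-weaken t rewrite occ-weaken-last t = refl

mentionsLast-graft : (t : Tm n) (s : Pos t) (b : Bool) (t₁ : Tm 1) →
                     occ zero t₁ ≡ 1 → mentionsLast (graft t s b t₁) ≡ true
mentionsLast-graft t s b t₁ x∈t₁ rewrite occ-graft-last t s b t₁ | x∈t₁ = refl

split-graft : (t : Tm n) (s : Pos t) (b : Bool) (t₁ : Tm 1) →
              occ zero t₁ ≡ 1 → noClosedSub t ≡ true →
              split (graft t s b t₁) ≡ just (t , s , b , t₁)
split-graft {n} t here true t₁ x∈t₁ _
  rewrite mentionsLast-toLast {n} t₁ x∈t₁ | fromLast-toLast {n} t₁ | strengthen-weaken t = refl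
split-graft {n} t here false t₁ x∈t₁ _
  rewrite mentionsLast-weaken t | fromLast-toLast {n} t₁ | strengthen-weaken t = refl
split-graft (app t u) (appL s) b t₁ x∈t₁ ntu
  with nt , _ ← noClosedSub-app⁻ t u ntu
  rewrite mentionsLast-graft t s b t₁ x∈t₁ | graft-notFromLast t s b t₁ (noClosedSub⇒¬closed t nt)
        | split-graft t s b t₁ x∈t₁ nt | strengthen-weaken u = refl
split-graft (app t u) (appR s) b t₁ x∈t₁ ntu
  with _ , nu ← noClosedSub-app⁻ t u ntu
  rewrite mentionsLast-weaken t | graft-notFromLast u s b t₁ (noClosedSub⇒¬closed u nu)
        | split-graft u s b t₁ x∈t₁ nu | strengthen-weaken t = refl
split-graft (lam t) (under s) b t₁ x∈t₁ nt
  rewrite split-graft t s b t₁ x∈t₁ (noClosedSub-lam⁻ t nt) = refl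

split-complete : (u : Tm (suc n)) → occ (fromℕ n) u ≡ 1 → fromLast u ≡ nothing →
                 linBound u ≡ true → SplitsOpenly u
split-completeˡ : (p q : Tm (suc n)) → occ (fromℕ n) p ≡ 1 → occ (fromℕ n) q ≡ 0 →
                  linBound p ≡ true →
                  ∃ λ r → splitAppˡ (fromLast p) (split p) (strengthen q) ≡ just r × OpenAboveMark r
split-completeʳ : (p q : Tm (suc n)) → occ (fromℕ n) p ≡ 0 → occ (fromℕ n) q ≡ 1 →
                  linBound q ≡ true →
                  ∃ λ r → splitAppʳ (fromLast q) (split q) (strengthen p) ≡ just r × OpenAboveMark r

split-complete {n} (var j) x∈u notLast _ with onlyLast j in e
split-complete {n} (var j) x∈u () _ | just _
... | nothing with onlyLast≡nothing j e
... | i , refl with trans (sym x∈u) (occ-var-≢ fromℕ≢inject₁)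
... | ()
split-complete {n} (app p q) x∈u _ lin with mentionsLast p in left
... | true  with x∈p , x∉q ← m+n≡1⇒m≡1×n≡0 (occ (fromℕ n) p) (occ (fromℕ n) q) x∈u left =
  split-completeˡ p q x∈p x∉q (∧-conicalˡ _ _ lin)
... | false with x∉p , x∈q ← m+n≡1⇒m≡0×n≡1 (occ (fromℕ n) p) (occ (fromℕ n) q) x∈u left =
  split-completeʳ p q x∉p x∈q (∧-conicalʳ (linBound p) _ lin)
split-complete (lam p) x∈u notLast lin
  with y∈p , linp ← linBound-lam⁻ p lin
  with (t , s , b , t₁) , sp , above ← split-complete p x∈u (occ-zero⇒notFromLast p y∈p) linp
  rewrite sp = (lam t , under s , b , t₁) , refl , lam-open , above
  where
  lam-open : closed (lam t) ≡ false
  lam-open = graft-notFromLast⁻ (lam t) (under s) b t₁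
               (subst (λ p → fromLast (lam p) ≡ nothing) (sym (plug-split p sp)) notLast)

split-completeˡ p q x∈p x∉q linp
  with q′ , sq ← strengthen-defined q x∉q rewrite sq with fromLast p in p₁
... | just t₁ = (q′ , here , true , t₁) , refl , tt
... | nothing
  with (t , s , b , t₁) , sp , above ← split-complete p x∈p p₁ linp
  rewrite sp = (app t q′ , appL s , b , t₁) , refl , app-open , above
  where
  app-open : closed (app t q′) ≡ false
  app-open = graft-notFromLast⁻ (app t q′) (appL s) b t₁
               (subst (λ p → fromLast (app p (weaken q′)) ≡ nothing) (sym (plug-split p sp))
                      (prename-appˡ onlyLast p (weaken q′) p₁))

split-completeʳ p q x∉p x∈q linq
  with p′ , sp′ ← strengthen-defined p x∉p rewrite sp′ with fromLast q in q₁
... | just t₁ = (p′ , here , false , t₁) , refl , tt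
... | nothing
  with (t , s , b , t₁) , sq , above ← split-complete q x∈q q₁ linq
  rewrite sq = (app p′ t , appR s , b , t₁) , refl , app-open , above
  where
  app-open : closed (app p′ t) ≡ false
  app-open = graft-notFromLast⁻ (app p′ t) (appR s) b t₁
               (subst (λ q → fromLast (app (weaken p′) q) ≡ nothing) (sym (plug-split q sq))
                      (prename-appʳ onlyLast (weaken p′) q q₁))

-- The decomposition of B₁

B1-elim : (t : Tm 1) → T (isB1 t) → occ zero t ≡ 1 × linBound t ≡ true × noClosedSub t ≡ true
B1-elim t h with occ zero t ≡ᵇ 1 in x∈t | linBound t | noClosedSub t | h
... | true | true | true | _ = ≡ᵇ⇒≡ (occ zero t) 1 (Equivalence.from T-≡ x∈t) , refl , refl

B1-intro : (t : Tm 1) → occ zero t ≡ 1 → linBound t ≡ true → noClosedSub t ≡ true → T (isB1 t)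
B1-intro t x∈t lin ncs rewrite x∈t | lin | ncs = tt

noClosedSub⇒occ-zero≢0 : (u : Tm 1) → noClosedSub u ≡ true → occ zero u ≢ 0
noClosedSub⇒occ-zero≢0 u ncs x∉u
  with trans (sym (noClosedSub⇒¬closed u ncs)) (occ≡0⇒closed u λ { zero → x∉u })
... | ()

B1-¬app : (p q : Tm 1) → ¬ T (isB1 (app p q))
B1-¬app p q h with x∈pq , _ , ncs ← B1-elim (app p q) h with np , nq ← noClosedSub-app⁻ p q ncs
  with occ zero p in x∈p | occ zero q in x∈q | x∈pq
... | zero        | _       | _ = noClosedSub⇒occ-zero≢0 p np x∈p
... | suc zero    | zero    | _ = noClosedSub⇒occ-zero≢0 q nq x∈q
... | suc zero    | suc _   | ()
... | suc (suc _) | _       | ()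

B1-lam-graft : (t₂ : Tm 1) (s : Pos t₂) (b : Bool) (t₁ : Tm 1) →
               T (isB1 t₁) → T (isB1 t₂) → T (isB1 (lam (graft t₂ s b t₁)))
B1-lam-graft t₂ s b t₁ h₁ h₂ with B1-elim t₁ h₁ | B1-elim t₂ h₂
... | x∈t₁ , lin₁ , ncs₁ | y∈t₂ , lin₂ , ncs₂ =
  B1-intro (lam g) x∈g lin
    (noClosedSub-lam g (occ≡suc⇒¬closed (lam g) zero x∈g) (noClosedSub-graft t₂ s b t₁ x∈t₁ ncs₂ ncs₁))
  where
  g = graft t₂ s b t₁
  x∈g : occ zero (lam g) ≡ 1
  x∈g = trans (occ-graft-last t₂ s b t₁) x∈t₁
  lin : linBound (lam g) ≡ true
  lin rewrite occ-graft-inject₁ zero t₂ s b t₁ | linBound-graft t₂ s b t₁ | y∈t₂ | lin₁ | lin₂ = refl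

B1-lam-graft⁻ : (t₂ : Tm 1) (s : Pos t₂) (b : Bool) (t₁ : Tm 1) → OpenAbove t₂ s →
                T (isB1 (lam (graft t₂ s b t₁))) → T (isB1 t₁) × T (isB1 t₂)
B1-lam-graft⁻ t₂ s b t₁ above h with B1-elim (lam (graft t₂ s b t₁)) h
... | x∈g , lin , ncs =
  B1-intro t₁ (trans (sym (occ-graft-last t₂ s b t₁)) x∈g) (∧-conicalʳ (linBound t₂) _ lin₂₁) ncs₁ ,
  B1-intro t₂ (trans (sym (occ-graft-inject₁ zero t₂ s b t₁)) y∈g) (∧-conicalˡ _ _ lin₂₁) ncs₂
  where
  g = graft t₂ s b t₁
  y∈g = proj₁ (linBound-lam⁻ g lin)
  lin₂₁ = trans (sym (linBound-graft t₂ s b t₁)) (proj₂ (linBound-lam⁻ g lin))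
  ncs₂ = proj₁ (noClosedSub-graft⁻ t₂ s b t₁ above (noClosedSub-lam⁻ g ncs))
  ncs₁ = proj₂ (noClosedSub-graft⁻ t₂ s b t₁ above (noClosedSub-lam⁻ g ncs))

split-B1 : (u : Tm 2) → T (isB1 (lam u)) → SplitsOpenly u
split-B1 u h with x∈u , lin , _ ← B1-elim (lam u) h with y∈u , linu ← linBound-lam⁻ u lin =
  split-complete u x∈u (occ-zero⇒notFromLast u y∈u) linu

split-B1-graft : (t₂ : Tm 1) (s : Pos t₂) (b : Bool) (t₁ : Tm 1) → T (isB1 t₁) → T (isB1 t₂) →
                 split (graft t₂ s b t₁) ≡ just (t₂ , s , b , t₁)
split-B1-graft t₂ s b t₁ h₁ h₂ =
  split-graft t₂ s b t₁ (proj₁ (B1-elim t₁ h₁)) (proj₂ (proj₂ (B1-elim t₂ h₂)))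

B1-≡ : {t t′ : Tm 1} {h : T (isB1 t)} {h′ : T (isB1 t′)} →
       t ≡ t′ → _≡_ {A = B1} (t , h) (t′ , h′)
B1-≡ {h = h} {h′} refl = cong (_ ,_) (T-irrelevant h h′)

fromRHS : RHS → B1
fromRHS (inj₁ _)                                 = var zero , tt
fromRHS (inj₂ (b , (t₁ , h₁) , ((t₂ , h₂) , s))) = lam (graft t₂ s b t₁) , B1-lam-graft t₂ s b t₁ h₁ h₂

decompose : (u : Tm 2) → T (isB1 (lam u)) → SplitsOpenly u → RHS
decompose u h ((t₂ , s , b , t₁) , su , above) =
  inj₂ (b , (t₁ , proj₁ parts) , ((t₂ , proj₂ parts) , s))
  where
  parts = B1-lam-graft⁻ t₂ s b t₁ above (subst (λ v → T (isB1 (lam v))) (sym (plug-split u su)) h)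

toRHS : B1 → RHS
toRHS (var zero , _) = inj₁ tt
toRHS (app p q  , h) = contradiction h (B1-¬app p q)
toRHS (lam u    , h) = decompose u h (split-B1 u h)

toRHS-fromRHS : ∀ y → toRHS (fromRHS y) ≡ y
toRHS-fromRHS (inj₁ tt) = refl
toRHS-fromRHS (inj₂ (b , (t₁ , h₁) , ((t₂ , h₂) , s)))
  with (t₂′ , s′ , b′ , t₁′) , su , _ ← split-B1 (graft t₂ s b t₁) (B1-lam-graft t₂ s b t₁ h₁ h₂)
  with refl ← just-injective (trans (sym su) (split-B1-graft t₂ s b t₁ h₁ h₂)) =
  cong₂ (λ h₁′ h₂′ → inj₂ (b , (t₁ , h₁′) , ((t₂ , h₂′) , s))) (T-irrelevant _ _) (T-irrelevant _ _)

fromRHS-toRHS : ∀ x → fromRHS (toRHS x) ≡ x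
fromRHS-toRHS (var zero , h) = B1-≡ refl
fromRHS-toRHS (app p q  , h) = contradiction h (B1-¬app p q)
fromRHS-toRHS (lam u    , h) with (t₂ , s , b , t₁) , su , _ ← split-B1 u h =
  B1-≡ (cong lam (plug-split u su))

size-toRHS : (x : B1) → sizeRHS (toRHS x) ≡ sizeB1 x
size-toRHS (var zero , h) = refl
size-toRHS (app p q  , h) = contradiction h (B1-¬app p q)
size-toRHS (lam u    , h) with (t₂ , s , b , t₁) , su , _ ← split-B1 u h =
  cong suc (trans (cong suc (+-comm (size t₁) (size t₂)))
                  (trans (sym (size-graft t₂ s b t₁)) (cong size (plug-split u su))))

mainTheorem12 : Σ (B1 ↔ RHS) (λ f → (b : B1) → sizeRHS (Inverse.to f b) ≡ sizeB1 b)
mainTheorem12 = mk↔ₛ′ toRHS fromRHS toRHS-fromRHS fromRHS-toRHS , size-toRHS
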